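{- Let $H$ be a tournament. If $H$ has a $3$-locally bounded $\tau$-retentive set $R$ such that (1) $V(H)\setminus R\neq\emptyset$ and (2) $|N^-_H(v)|\leq 5$ for every $v\in R$, then $H$ is not a $\tau$-retentive tournament.
   Context: A tournament $T$ consists of a finite vertex set $V(T)$ and an asymmetric, complete binary relation $\succ$ on $V(T)$ ($x$ dominates $y$ if $x\succ y$). For $v\in V(T)$ let $N^-_T(v)=\{u: u\succ v\}$; for $B\subseteq V(T)$, $T[B]$ is the induced subtournament. The tournament equilibrium set $\tau$ is defined recursively: a nonempty $A\subseteq V(T)$ is $\tau$-retentive if for every $x\in A$ with $N^-_T(x)\neq\emptyset$, $\tau(T[N^-_T(x)])\subseteq A$; $A$ is a minimal $\tau$-retentive set if no $\tau$-retentive set of $T$ is a proper subset of $A$; $\tau(T)$ is the union of all minimal $\tau$-retentive sets of $T$. A $\tau$-retentive set $R$ of $T$ is $c$-locally bounded if $|\tau(T[N^-_T(v)])|\leq c$ for every $v\in R$. A tournament $H$ is a $\tau$-retentive tournament if there is a tournament $T$ with a minimal $\tau$-retentive set $S$ such that $T[S]$ is isomorphic to $H$. -}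

module Defs where

open import Data.Nat using (ℕ; zero; suc; _≤_)
open import Data.Bool using (Bool; true; false; _∧_)
open import Data.Fin using (Fin)
open import Data.Fin.Subset using (Subset; _∈_; _⊆_; _⊂_; Nonempty; ∣_∣; ⊤)
open import Data.Vec using (tabulate; lookup)
open import Data.Product using (Σ; _×_; ∃)
open import Data.Sum using (_⊎_)
open import Data.Empty using (⊥)
open import Relation.Nullary using (¬_)
open import Relation.Binary.PropositionalEquality using (_≡_; _≢_)

record Tournament (n : ℕ) : Set where
  field
    beats    : Fin n → Fin n → Bool
    asym     : ∀ x y → beats x y ≡ true → beats y x ≡ false
    complete : ∀ x y → x ≢ y → (beats x y ≡ true) ⊎ (beats y x ≡ true)
open Tournament public

_≻[_]_ : ∀ {n} → Fin n → Tournament n → Fin n → Set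
x ≻[ T ] y = beats T x y ≡ true

N⁻ : ∀ {n} → Tournament n → Subset n → Fin n → Subset n
N⁻ T B y = tabulate (λ x → lookup B x ∧ beats T x y)

-- Subtournaments of T are represented by their vertex set B ⊆ V(T).
-- τ is defined by recursion on a fuel parameter k; it is correct whenever
-- k ≥ |B| (every in-neighbourhood in T[B] is strictly smaller than B).
mutual
  RetentiveF : ∀ {n} → Tournament n → ℕ → Subset n → Subset n → Set
  RetentiveF T k B A =
    A ⊆ B × Nonempty A ×
    (∀ x → x ∈ A → Nonempty (N⁻ T B x) →
       ∀ z → τF T k (N⁻ T B x) z → z ∈ A)

  MinRetentiveF : ∀ {n} → Tournament n → ℕ → Subset n → Subset n → Set
  MinRetentiveF T k B A =
    RetentiveF T k B A × (∀ A′ → RetentiveF T k B A′ → ¬ (A′ ⊂ A))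

  τF : ∀ {n} → Tournament n → ℕ → Subset n → Fin n → Set
  τF T zero    B z = ⊥
  τF T (suc k) B z = Σ (Subset _) λ A → MinRetentiveF T k B A × z ∈ A

-- With fuel n (≥ |B| for every B ⊆ Fin n) these are the genuine notions.
τ : ∀ {n} → Tournament n → Subset n → Fin n → Set
τ {n} T B = τF T n B

Retentive : ∀ {n} → Tournament n → Subset n → Set
Retentive {n} T A = RetentiveF T n ⊤ A

MinRetentive : ∀ {n} → Tournament n → Subset n → Set
MinRetentive {n} T A = MinRetentiveF T n ⊤ A

-- |X| ≤ c for a set given by a predicate: it is contained in a subset of size ≤ c
AtMost : ∀ {n} → ℕ → (Fin n → Set) → Set
AtMost {n} c P = Σ (Subset n) λ X → (∀ z → P z → z ∈ X) × ∣ X ∣ ≤ c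

LocallyBounded : ∀ {n} → ℕ → Tournament n → Subset n → Set
LocallyBounded c T R =
  Retentive T R × (∀ v → v ∈ R → AtMost c (τ T (N⁻ T ⊤ v)))

InducedIso : ∀ {h m} → Tournament h → Tournament m → Subset m → Set
InducedIso {h} {m} H T S =
  Σ (Fin h → Fin m) λ f →
    (∀ i j → f i ≡ f j → i ≡ j) ×
    (∀ x → x ∈ S → ∃ λ i → f i ≡ x) ×
    (∀ i → f i ∈ S) ×
    (∀ i j → beats H i j ≡ beats T (f i) (f j))

IsTauRetentiveTournament : ∀ {h} → Tournament h → Set
IsTauRetentiveTournament H =
  Σ ℕ λ m → Σ (Tournament m) λ T → Σ (Subset m) λ S →
    MinRetentive T S × InducedIso H T S

-- Suppose f embeds H as T[S], where S is a minimal τ-retentive set of T. A tournament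
-- on at most five vertices has exactly one minimal τ-retentive set: a vertex without
-- in-neighbours lies in every τ-retentive set, so each of two disjoint τ-retentive
-- sets would contain a directed path on three vertices. Using this, induction on the
-- size shows that if f(B₁) ⊆ B₂, |B₁| ≤ 5 and τ(T[B₂]) ⊆ f(B₁), then f maps
-- τ(H[B₁]) onto τ(T[B₂]). This applies to B₁ = N⁻_H(v), B₂ = N⁻_T(f v) for v ∈ R,
-- since τ(T[N⁻_T(f v)]) ⊆ S = f(V(H)). Hence f(R) is τ-retentive in T, and it is a
-- proper subset of S because R ≠ V(H), contradicting the minimality of S.
module Submission where

open import Defs
open import Level using (0ℓ)
open import Function using (_∘_)
open import Function.Bundles using (Equivalence)
open import Data.Nat using (ℕ; zero; suc; _+_; _≤_; _<_; _≤?_; z≤n; s≤s)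
open import Data.Nat.Properties
  using ( module ≤-Reasoning; ≤-trans; ≤-pred; <-≤-trans; ≤-<-trans; +-suc; +-mono-≤
        ; m≤n⇒m≤1+n; <⇒≱; 1+n≰n)
open import Data.Bool using (Bool; true; _∧_)
open import Data.Bool.Properties using (∧-conicalˡ; ∧-conicalʳ; T-≡)
open import Data.Fin using (Fin; zero; _≟_)
open import Data.Fin.Properties using (any?)
open import Data.Fin.Subset
  using (Subset; inside; outside; _∈_; _∉_; _⊆_; _⊂_; ∁; Nonempty; Empty; ∣_∣; ⊤; ⁅_⁆; _∩_; _-_)
open import Data.Fin.Subset.Properties
  using ( _∈?_; nonempty?; ∈⊤; ∣p∣≤n; ∣p∣≤∣x∷p∣; p⊆q⇒∣p∣≤∣q∣; p⊂q⇒p⊆q; x∈p⇒∣p-x∣<∣p∣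
        ; x∈p∧x≢y⇒x∈p-y; x∈⁅x⁆; x∈⁅y⁆⇒x≡y; x∈p∩q⁺; x∈p∩q⁻; p∩q⊆p; ∩-comm
        ; drop-∷-⊆; drop-∷-Empty; x∈∁p⇒x∉p)
open import Data.Fin.Subset.Induction using (Acc; acc; ⊂-wellFounded)
open import Data.Vec using ([]; _∷_; here; tabulate; lookup)
open import Data.Vec.Properties using (lookup∘tabulate; []=⇒lookup; lookup⇒[]=)
open import Data.List using (List; []; _∷_; length)
open import Data.List.Relation.Unary.All as All using (All; []; _∷_)
open import Data.List.Relation.Unary.AllPairs using (AllPairs; []; _∷_)
open import Data.Product using (∃; ∃-syntax; _×_; _,_; proj₁; proj₂)
open import Data.Sum using (inj₁; inj₂)
open import Data.Empty using (⊥-elim)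
open import Effect.Monad using (RawMonad)
open import Relation.Nullary using (¬_; yes; no; contradiction)
open import Relation.Nullary.Negation using (¬¬-Monad)
open import Relation.Nullary.Decidable
  using (isYes; fromWitness; toWitness; decidable-stable; ¬¬-excluded-middle; _×-dec_)
open import Relation.Binary.PropositionalEquality using (_≡_; _≢_; refl; sym; trans; subst; cong₂)

-- Minimal τ-retentive sets exist only classically; as the theorem is a negation,
-- the argument runs in the double-negation monad.
open RawMonad (¬¬-Monad {a = 0ℓ}) using (_>>=_; pure)

∈-tabulate⁺ : ∀ {n} {f : Fin n → Bool} {x} → f x ≡ true → x ∈ tabulate f
∈-tabulate⁺ {f = f} {x} fx≡true = lookup⇒[]= x _ (trans (lookup∘tabulate f x) fx≡true)

∈-tabulate⁻ : ∀ {n} {f : Fin n → Bool} {x} → x ∈ tabulate f → f x ≡ true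
∈-tabulate⁻ {f = f} {x} x∈ = trans (sym (lookup∘tabulate f x)) ([]=⇒lookup x∈)

∣p∣≤0⇒x∉p : ∀ {n} {p : Subset n} {x} → ∣ p ∣ ≤ 0 → x ∉ p
∣p∣≤0⇒x∉p ∣p∣≤0 x∈p = <⇒≱ (≤-<-trans z≤n (x∈p⇒∣p-x∣<∣p∣ x∈p)) ∣p∣≤0

distinct⇒length≤∣p∣ : ∀ {n} {p : Subset n} {xs : List (Fin n)} →
                      AllPairs _≢_ xs → All (_∈ p) xs → length xs ≤ ∣ p ∣
distinct⇒length≤∣p∣ [] [] = z≤n
distinct⇒length≤∣p∣ (x≢xs ∷ xs-distinct) (x∈p ∷ xs⊆p) =
  ≤-trans (s≤s (distinct⇒length≤∣p∣ xs-distinct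
                 (All.zipWith (λ (x≢y , y∈p) → x∈p∧x≢y⇒x∈p-y y∈p (x≢y ∘ sym)) (x≢xs , xs⊆p))))
          (x∈p⇒∣p-x∣<∣p∣ x∈p)

disjoint⇒∣p∣+∣q∣≤∣r∣ : ∀ {n} {p q r : Subset n} → Empty (p ∩ q) → p ⊆ r → q ⊆ r →
                       ∣ p ∣ + ∣ q ∣ ≤ ∣ r ∣
disjoint⇒∣p∣+∣q∣≤∣r∣ {p = []} {[]} {[]} _ _ _ = z≤n
disjoint⇒∣p∣+∣q∣≤∣r∣ {p = inside ∷ p} {inside ∷ q} disjoint _ _ = ⊥-elim (disjoint (zero , here))
disjoint⇒∣p∣+∣q∣≤∣r∣ {p = inside ∷ p} {outside ∷ q} {_ ∷ r} disjoint p⊆r q⊆r with p⊆r here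
... | here = s≤s (disjoint⇒∣p∣+∣q∣≤∣r∣ (drop-∷-Empty disjoint) (drop-∷-⊆ p⊆r) (drop-∷-⊆ q⊆r))
disjoint⇒∣p∣+∣q∣≤∣r∣ {p = outside ∷ p} {inside ∷ q} {_ ∷ r} disjoint p⊆r q⊆r with q⊆r here
... | here = subst (_≤ suc ∣ r ∣) (sym (+-suc ∣ p ∣ ∣ q ∣))
                (s≤s (disjoint⇒∣p∣+∣q∣≤∣r∣ (drop-∷-Empty disjoint) (drop-∷-⊆ p⊆r) (drop-∷-⊆ q⊆r)))
disjoint⇒∣p∣+∣q∣≤∣r∣ {p = outside ∷ p} {outside ∷ q} {s ∷ r} disjoint p⊆r q⊆r =
  ≤-trans (disjoint⇒∣p∣+∣q∣≤∣r∣ (drop-∷-Empty disjoint) (drop-∷-⊆ p⊆r) (drop-∷-⊆ q⊆r))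
          (∣p∣≤∣x∷p∣ s r)

≻-asym : ∀ {n} (T : Tournament n) {x y} → x ≻[ T ] y → ¬ (y ≻[ T ] x)
≻-asym T {x} {y} x≻y y≻x with () ← trans (sym y≻x) (asym T x y x≻y)

≻-irrefl : ∀ {n} (T : Tournament n) {x} → ¬ (x ≻[ T ] x)
≻-irrefl T x≻x = ≻-asym T x≻x x≻x

≻-path-distinct : ∀ {n} (T : Tournament n) {a b c} → b ≻[ T ] a → c ≻[ T ] b →
                  AllPairs _≢_ (a ∷ b ∷ c ∷ [])
≻-path-distinct T b≻a c≻b =
  ((λ { refl → ≻-irrefl T b≻a }) ∷ (λ { refl → ≻-asym T b≻a c≻b }) ∷ []) ∷
  ((λ { refl → ≻-irrefl T c≻b }) ∷ []) ∷ [] ∷ []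

module _ {n} (T : Tournament n) {B : Subset n} where

  x∈N⁻⁺ : ∀ {x y} → x ∈ B → x ≻[ T ] y → x ∈ N⁻ T B y
  x∈N⁻⁺ x∈B x≻y = ∈-tabulate⁺ (cong₂ _∧_ ([]=⇒lookup x∈B) x≻y)

  x∈N⁻⁻ : ∀ {x y} → x ∈ N⁻ T B y → x ∈ B × x ≻[ T ] y
  x∈N⁻⁻ {x} x∈N = lookup⇒[]= x B (∧-conicalˡ _ _ x∈N⁻) , ∧-conicalʳ _ _ x∈N⁻
    where x∈N⁻ = ∈-tabulate⁻ x∈N

  N⁻⊆ : ∀ {y} → N⁻ T B y ⊆ B
  N⁻⊆ = proj₁ ∘ x∈N⁻⁻

  ∣N⁻∣≤∣B∣ : ∀ {y} → ∣ N⁻ T B y ∣ ≤ ∣ B ∣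
  ∣N⁻∣≤∣B∣ = p⊆q⇒∣p∣≤∣q∣ N⁻⊆

  ∣N⁻∣<∣B∣ : ∀ {y} → y ∈ B → ∣ N⁻ T B y ∣ < ∣ B ∣
  ∣N⁻∣<∣B∣ {y} y∈B = ≤-<-trans (p⊆q⇒∣p∣≤∣q∣ N⁻⊆B-y) (x∈p⇒∣p-x∣<∣p∣ y∈B)
    where
    N⁻⊆B-y : N⁻ T B y ⊆ B - y
    N⁻⊆B-y x∈N with x∈B , x≻y ← x∈N⁻⁻ x∈N = x∈p∧x≢y⇒x∈p-y x∈B λ { refl → ≻-irrefl T x≻y }

  ∣B∣≤1+k⇒∣N⁻∣≤k : ∀ {k y} → y ∈ B → ∣ B ∣ ≤ suc k → ∣ N⁻ T B y ∣ ≤ k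
  ∣B∣≤1+k⇒∣N⁻∣≤k y∈B ∣B∣≤1+k = ≤-pred (<-≤-trans (∣N⁻∣<∣B∣ y∈B) ∣B∣≤1+k)

module _ {n} (T : Tournament n) where

  τF⊆ : ∀ k B {z} → τF T k B z → z ∈ B
  τF⊆ (suc k) B (A , ((A⊆B , _) , _) , z∈A) = A⊆B z∈A

  retentive-whole : ∀ {k B} → Nonempty B → RetentiveF T k B B
  retentive-whole {k} ne = (λ x∈B → x∈B) , ne , λ _ _ _ _ z∈τ → N⁻⊆ T (τF⊆ k _ z∈τ)

  ∩-retentive : ∀ {k B A A′} → RetentiveF T k B A → RetentiveF T k B A′ → Nonempty (A ∩ A′) →
                RetentiveF T k B (A ∩ A′)
  ∩-retentive {A = A} {A′} (A⊆B , _ , A-closed) (_ , _ , A′-closed) meet =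
    A⊆B ∘ proj₁ ∘ x∈p∩q⁻ A A′ , meet ,
    λ x x∈A∩A′ N≢∅ z z∈τ → let (x∈A , x∈A′) = x∈p∩q⁻ A A′ x∈A∩A′ in
      x∈p∩q⁺ (A-closed x x∈A N≢∅ z z∈τ , A′-closed x x∈A′ N≢∅ z z∈τ)

  ∃-minimal-retentive-⊆ : ∀ {k B A} → RetentiveF T k B A →
                          ¬ ¬ (∃[ M ] MinRetentiveF T k B M × M ⊆ A)
  ∃-minimal-retentive-⊆ {k} {B} = go (⊂-wellFounded _)
    where
    go : ∀ {A} → Acc _⊂_ A → RetentiveF T k B A → ¬ ¬ (∃[ M ] MinRetentiveF T k B M × M ⊆ A)
    go {A} (acc smaller) A-ret = do
      yes (A′ , A′-ret , A′⊂A) ← ¬¬-excluded-middle {A = ∃[ A′ ] RetentiveF T k B A′ × A′ ⊂ A}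
        where no none-smaller →
                pure (A , (A-ret , λ A′ A′-ret A′⊂A → none-smaller (A′ , A′-ret , A′⊂A)) ,
                      λ {_} x∈A → x∈A)
      (M , M-min , M⊆A′) ← go (smaller A′⊂A) A′-ret
      pure (M , M-min , λ {_} x∈M → p⊂q⇒p⊆q A′⊂A (M⊆A′ x∈M))

  τF-nonempty : ∀ {k B} → Nonempty B → ∣ B ∣ ≤ k → ¬ ¬ (∃ (τF T k B))
  τF-nonempty {zero} (x , x∈B) ∣B∣≤0 = contradiction x∈B (∣p∣≤0⇒x∉p ∣B∣≤0)
  τF-nonempty {suc k} ne _ = do
    (M , M-min@((_ , (z , z∈M) , _) , _) , _) ← ∃-minimal-retentive-⊆ (retentive-whole ne)
    pure (z , M , M-min , z∈M)

  Unbeaten : Subset n → Fin n → Set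
  Unbeaten B c = ∀ {w} → w ∈ B → ¬ (w ≻[ T ] c)

  unbeaten⇒⁅⁆-minimal : ∀ {k B c} → c ∈ B → Unbeaten B c → MinRetentiveF T k B ⁅ c ⁆
  unbeaten⇒⁅⁆-minimal {k} {B} {c} c∈B unbeaten = (⁅c⁆⊆B , (c , x∈⁅x⁆ c) , closed) , minimal
    where
    ⁅c⁆⊆B : ⁅ c ⁆ ⊆ B
    ⁅c⁆⊆B x∈⁅c⁆ with refl ← x∈⁅y⁆⇒x≡y c x∈⁅c⁆ = c∈B
    closed : ∀ x → x ∈ ⁅ c ⁆ → Nonempty (N⁻ T B x) → ∀ z → τF T k (N⁻ T B x) z → z ∈ ⁅ c ⁆
    closed x x∈⁅c⁆ (w , w∈N) with refl ← x∈⁅y⁆⇒x≡y c x∈⁅c⁆ with w∈B , w≻c ← x∈N⁻⁻ T w∈N =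
      contradiction w≻c (unbeaten w∈B)
    minimal : ∀ A → RetentiveF T k B A → ¬ (A ⊂ ⁅ c ⁆)
    minimal A (_ , (w , w∈A) , _) (A⊆⁅c⁆ , x , x∈⁅c⁆ , x∉A)
      with refl ← x∈⁅y⁆⇒x≡y c (A⊆⁅c⁆ w∈A) | refl ← x∈⁅y⁆⇒x≡y c x∈⁅c⁆ = x∉A w∈A

  unbeaten∈τF : ∀ {k B c} → c ∈ B → Unbeaten B c → ∣ B ∣ ≤ k → τF T k B c
  unbeaten∈τF {zero} c∈B _ ∣B∣≤0 = contradiction c∈B (∣p∣≤0⇒x∉p ∣B∣≤0)
  unbeaten∈τF {suc k} {c = c} c∈B unbeaten _ = ⁅ c ⁆ , unbeaten⇒⁅⁆-minimal c∈B unbeaten , x∈⁅x⁆ c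

  unbeaten∈retentive : ∀ {k B A c} → ∣ B ∣ ≤ suc k → c ∈ B → Unbeaten B c →
                       RetentiveF T k B A → c ∈ A
  unbeaten∈retentive {c = c} ∣B∣≤1+k c∈B unbeaten (A⊆B , (y , y∈A) , A-closed) with c ≟ y
  ... | yes refl = y∈A
  ... | no c≢y with complete T c y c≢y
  ...   | inj₂ y≻c = contradiction y≻c (unbeaten (A⊆B y∈A))
  ...   | inj₁ c≻y = A-closed y y∈A (c , c∈N) c
                       (unbeaten∈τF c∈N (unbeaten ∘ N⁻⊆ T) (∣B∣≤1+k⇒∣N⁻∣≤k T (A⊆B y∈A) ∣B∣≤1+k))
    where c∈N = x∈N⁻⁺ T c∈B c≻y

  beaten⇒beaten-within : ∀ {k B A a} → ∣ B ∣ ≤ suc k → RetentiveF T k B A → a ∈ A →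
                         ¬ Unbeaten B a → ¬ ¬ (∃[ b ] b ∈ A × b ≻[ T ] a)
  beaten⇒beaten-within {k} {B} {a = a} ∣B∣≤1+k (A⊆B , _ , A-closed) a∈A beaten = do
    N≢∅ ← λ N≡∅ → beaten λ w∈B w≻a → N≡∅ (_ , x∈N⁻⁺ T w∈B w≻a)
    (b , b∈τ) ← τF-nonempty N≢∅ (∣B∣≤1+k⇒∣N⁻∣≤k T (A⊆B a∈A) ∣B∣≤1+k)
    pure (b , A-closed a a∈A N≢∅ b b∈τ , proj₂ (x∈N⁻⁻ T {B} (τF⊆ k _ b∈τ)))

  disjoint-retentive⇒3≤∣A∣ : ∀ {k B A A′} → ∣ B ∣ ≤ suc k →
    RetentiveF T k B A → RetentiveF T k B A′ → Empty (A ∩ A′) → 3 ≤ ∣ A ∣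
  disjoint-retentive⇒3≤∣A∣ {B = B} {A} ∣B∣≤1+k A-ret@(A⊆B , (a , a∈A) , _) A′-ret disjoint =
    decidable-stable (3 ≤? ∣ A ∣) do
      (b , b∈A , b≻a) ← beaten⇒beaten-within ∣B∣≤1+k A-ret a∈A (beaten a∈A)
      (c , c∈A , c≻b) ← beaten⇒beaten-within ∣B∣≤1+k A-ret b∈A (beaten b∈A)
      pure (distinct⇒length≤∣p∣ (≻-path-distinct T b≻a c≻b) (a∈A ∷ b∈A ∷ c∈A ∷ []))
    where
    beaten : ∀ {x} → x ∈ A → ¬ Unbeaten B x
    beaten x∈A unbeaten =
      disjoint (_ , x∈p∩q⁺ (x∈A , unbeaten∈retentive ∣B∣≤1+k (A⊆B x∈A) unbeaten A′-ret))

  minimal-retentive-unique : ∀ {k B A A′} → ∣ B ∣ ≤ 5 → ∣ B ∣ ≤ suc k →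
    MinRetentiveF T k B A → MinRetentiveF T k B A′ → A ⊆ A′
  minimal-retentive-unique {B = B} {A} {A′} ∣B∣≤5 ∣B∣≤1+k (A-ret , A-min) (A′-ret , _) {z} z∈A
    with nonempty? (A ∩ A′)
  ... | yes meet = decidable-stable (z ∈? A′) λ z∉A′ →
          A-min (A ∩ A′) (∩-retentive A-ret A′-ret meet)
                (p∩q⊆p A A′ , z , z∈A , z∉A′ ∘ proj₂ ∘ x∈p∩q⁻ A A′)
  ... | no disjoint = ⊥-elim (1+n≰n (begin
          6                 ≤⟨ +-mono-≤ (disjoint-retentive⇒3≤∣A∣ ∣B∣≤1+k A-ret A′-ret disjoint)
                                        (disjoint-retentive⇒3≤∣A∣ ∣B∣≤1+k A′-ret A-ret disjoint′) ⟩
          ∣ A ∣ + ∣ A′ ∣    ≤⟨ disjoint⇒∣p∣+∣q∣≤∣r∣ disjoint (proj₁ A-ret) (proj₁ A′-ret) ⟩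
          ∣ B ∣             ≤⟨ ∣B∣≤5 ⟩
          5                 ∎))
    where
    open ≤-Reasoning
    disjoint′ : Empty (A′ ∩ A)
    disjoint′ = subst Empty (∩-comm A A′) disjoint

module Embedding {n₁ n₂} (T₁ : Tournament n₁) (T₂ : Tournament n₂) (g : Fin n₁ → Fin n₂)
  (g-injective : ∀ i j → g i ≡ g j → i ≡ j)
  (g-beats : ∀ i j → beats T₁ i j ≡ beats T₂ (g i) (g j)) where

  image : Subset n₁ → Subset n₂
  image A = tabulate λ z → isYes (any? λ y → (y ∈? A) ×-dec (g y ≟ z))

  ∈image⁺ : ∀ {A y z} → y ∈ A → g y ≡ z → z ∈ image A
  ∈image⁺ {A} {y} y∈A refl = ∈-tabulate⁺ (Equivalence.to T-≡ (fromWitness (y , y∈A , refl)))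

  ∈image⁻ : ∀ {A z} → z ∈ image A → ∃[ y ] y ∈ A × g y ≡ z
  ∈image⁻ z∈ = toWitness (Equivalence.from T-≡ (∈-tabulate⁻ z∈))

  g⁻¹ : Subset n₂ → Subset n₁
  g⁻¹ M = tabulate (lookup M ∘ g)

  ∈g⁻¹⁺ : ∀ {M y} → g y ∈ M → y ∈ g⁻¹ M
  ∈g⁻¹⁺ gy∈M = ∈-tabulate⁺ ([]=⇒lookup gy∈M)

  ∈g⁻¹⁻ : ∀ {M y} → y ∈ g⁻¹ M → g y ∈ M
  ∈g⁻¹⁻ {M} {y} y∈ = lookup⇒[]= (g y) M (∈-tabulate⁻ y∈)

  g-≻⁺ : ∀ {x y} → y ≻[ T₁ ] x → g y ≻[ T₂ ] g x
  g-≻⁺ {x} {y} = trans (sym (g-beats y x))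

  g-≻⁻ : ∀ {x y} → g y ≻[ T₂ ] g x → y ≻[ T₁ ] x
  g-≻⁻ {x} {y} = trans (g-beats y x)

  record Embedded (k₁ k₂ : ℕ) (B₁ : Subset n₁) (B₂ : Subset n₂) : Set where
    field
      fuel₁     : ∣ B₁ ∣ ≤ k₁
      fuel₂     : ∣ B₂ ∣ ≤ k₂
      maps-into : ∀ {y} → y ∈ B₁ → g y ∈ B₂

  record Aligned (k₁ k₂ : ℕ) (B₁ : Subset n₁) (B₂ : Subset n₂) : Set where
    field
      embedded : Embedded k₁ k₂ B₁ B₂
      small    : ∣ B₁ ∣ ≤ 5
      τ⊆image  : ∀ {z} → τF T₂ k₂ B₂ z → z ∈ image B₁
    open Embedded embedded public

  record τ-Corresponds (k₁ k₂ : ℕ) (B₁ : Subset n₁) (B₂ : Subset n₂) : Set where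
    field
      τ₂⊆gτ₁ : ∀ {z} → τF T₂ k₂ B₂ z → ∃[ z₁ ] g z₁ ≡ z × τF T₁ k₁ B₁ z₁
      gτ₁⊆τ₂ : ∀ {z₁} → τF T₁ k₁ B₁ z₁ → ¬ ¬ τF T₂ k₂ B₂ (g z₁)

  Transfer : ℕ → ℕ → Set
  Transfer k₁ k₂ = ∀ {B₁ B₂} → Aligned k₁ k₂ B₁ B₂ → τ-Corresponds k₁ k₂ B₁ B₂

  open τ-Corresponds

  neighbourhood-aligned : ∀ {k₁ k₂ B₁ B₂ M x} → Embedded (suc k₁) (suc k₂) B₁ B₂ →
    RetentiveF T₂ k₂ B₂ M → M ⊆ image B₁ → x ∈ B₁ → g x ∈ M → ∣ N⁻ T₁ B₁ x ∣ ≤ 5 →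
    Aligned k₁ k₂ (N⁻ T₁ B₁ x) (N⁻ T₂ B₂ (g x))
  neighbourhood-aligned {k₁} {k₂} {B₁} {B₂} {x = x} e (_ , _ , M-closed) M⊆image x∈B₁ gx∈M small =
    record
      { embedded = record
          { fuel₁     = ∣B∣≤1+k⇒∣N⁻∣≤k T₁ x∈B₁ fuel₁
          ; fuel₂     = ∣B∣≤1+k⇒∣N⁻∣≤k T₂ (maps-into x∈B₁) fuel₂
          ; maps-into = λ y∈N → let (y∈B₁ , y≻x) = x∈N⁻⁻ T₁ y∈N in
                          x∈N⁻⁺ T₂ (maps-into y∈B₁) (g-≻⁺ y≻x)
          }
      ; small    = small
      ; τ⊆image  = τ⊆image
      }
    where
    open Embedded e
    τ⊆image : ∀ {z} → τF T₂ k₂ (N⁻ T₂ B₂ (g x)) z → z ∈ image (N⁻ T₁ B₁ x)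
    τ⊆image z∈τ
      with z∈N ← τF⊆ T₂ k₂ _ z∈τ
      with y , y∈B₁ , refl ← ∈image⁻ (M⊆image (M-closed (g x) gx∈M (_ , z∈N) _ z∈τ)) =
      ∈image⁺ (x∈N⁻⁺ T₁ y∈B₁ (g-≻⁻ (proj₂ (x∈N⁻⁻ T₂ {B₂} z∈N)))) refl

  module _ {k₁ k₂} (ih : Transfer k₁ k₂) {B₁ B₂} (e : Embedded (suc k₁) (suc k₂) B₁ B₂) where

    image-retentive : ∀ {M A} → RetentiveF T₂ k₂ B₂ M → M ⊆ image B₁ →
      RetentiveF T₁ k₁ B₁ A → image A ⊆ M → (∀ {x} → x ∈ A → ∣ N⁻ T₁ B₁ x ∣ ≤ 5) →
      RetentiveF T₂ k₂ B₂ (image A)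
    image-retentive {A = A} M-ret@(M⊆B₂ , _) M⊆image (A⊆B₁ , (y , y∈A) , A-closed) image⊆M small =
      M⊆B₂ ∘ image⊆M , (g y , ∈image⁺ y∈A refl) , closed
      where
      closed : ∀ x → x ∈ image A → Nonempty (N⁻ T₂ B₂ x) →
               ∀ z → τF T₂ k₂ (N⁻ T₂ B₂ x) z → z ∈ image A
      closed x x∈ _ z z∈τ
        with x₁ , x₁∈A , refl ← ∈image⁻ x∈
        with z₁ , refl , z₁∈τ ← τ₂⊆gτ₁ (ih (neighbourhood-aligned e M-ret M⊆image (A⊆B₁ x₁∈A)
                                               (image⊆M x∈) (small x₁∈A))) z∈τ =
        ∈image⁺ (A-closed x₁ x₁∈A (z₁ , τF⊆ T₁ k₁ _ z₁∈τ) z₁ z₁∈τ) refl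

    preimage-retentive : ∀ {M} → ∣ B₁ ∣ ≤ 5 → RetentiveF T₂ k₂ B₂ M → M ⊆ image B₁ →
      RetentiveF T₁ k₁ B₁ (B₁ ∩ g⁻¹ M)
    preimage-retentive {M} small M-ret@(_ , (z , z∈M) , M-closed) M⊆image =
      proj₁ ∘ x∈p∩q⁻ B₁ (g⁻¹ M) , nonempty , closed
      where
      nonempty : Nonempty (B₁ ∩ g⁻¹ M)
      nonempty with y , y∈B₁ , refl ← ∈image⁻ (M⊆image z∈M) = y , x∈p∩q⁺ (y∈B₁ , ∈g⁻¹⁺ z∈M)
      closed : ∀ x → x ∈ B₁ ∩ g⁻¹ M → Nonempty (N⁻ T₁ B₁ x) →
               ∀ w → τF T₁ k₁ (N⁻ T₁ B₁ x) w → w ∈ B₁ ∩ g⁻¹ M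
      closed x x∈ _ w w∈τ = decidable-stable (w ∈? B₁ ∩ g⁻¹ M) do
          gw∈τ ← gτ₁⊆τ₂ (ih (neighbourhood-aligned e M-ret M⊆image x∈B₁ gx∈M
                                (≤-trans (∣N⁻∣≤∣B∣ T₁ {B₁}) small))) w∈τ
          pure (x∈p∩q⁺ (N⁻⊆ T₁ (τF⊆ T₁ k₁ _ w∈τ) ,
                        ∈g⁻¹⁺ (M-closed (g x) gx∈M (g w , τF⊆ T₂ k₂ _ gw∈τ) (g w) gw∈τ)))
        where
        x∈B₁ = proj₁ (x∈p∩q⁻ B₁ (g⁻¹ M) x∈)
        gx∈M = ∈g⁻¹⁻ (proj₂ (x∈p∩q⁻ B₁ (g⁻¹ M) x∈))

    preimage-minimal : ∀ {M} → ∣ B₁ ∣ ≤ 5 → MinRetentiveF T₂ k₂ B₂ M → M ⊆ image B₁ →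
      MinRetentiveF T₁ k₁ B₁ (B₁ ∩ g⁻¹ M)
    preimage-minimal {M} small (M-ret , M-min) M⊆image =
      preimage-retentive small M-ret M⊆image , minimal
      where
      minimal : ∀ A → RetentiveF T₁ k₁ B₁ A → ¬ (A ⊂ B₁ ∩ g⁻¹ M)
      minimal A A-ret (A⊆ , y , y∈ , y∉A) =
        M-min (image A)
              (image-retentive M-ret M⊆image A-ret image⊆M λ _ → ≤-trans (∣N⁻∣≤∣B∣ T₁ {B₁}) small)
              (image⊆M , g y , ∈g⁻¹⁻ (proj₂ (x∈p∩q⁻ B₁ (g⁻¹ M) y∈)) , gy∉image)
        where
        image⊆M : image A ⊆ M
        image⊆M z∈ with x , x∈A , refl ← ∈image⁻ z∈ = ∈g⁻¹⁻ (proj₂ (x∈p∩q⁻ B₁ (g⁻¹ M) (A⊆ x∈A)))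
        gy∉image : g y ∉ image A
        gy∉image gy∈ with x , x∈A , gx≡gy ← ∈image⁻ gy∈ =
          y∉A (subst (_∈ A) (g-injective x y gx≡gy) x∈A)

  transfer-step : ∀ {k₁ k₂} → Transfer k₁ k₂ → Transfer (suc k₁) (suc k₂)
  transfer-step {k₁} {k₂} ih {B₁} {B₂} aligned = record { τ₂⊆gτ₁ = τ₂⊆gτ₁′ ; gτ₁⊆τ₂ = gτ₁⊆τ₂′ }
    where
    open Aligned aligned
    minimal⊆image : ∀ {M} → MinRetentiveF T₂ k₂ B₂ M → M ⊆ image B₁
    minimal⊆image M-min z∈M = τ⊆image (_ , M-min , z∈M)
    preimage-of : ∀ {M} → MinRetentiveF T₂ k₂ B₂ M → MinRetentiveF T₁ k₁ B₁ (B₁ ∩ g⁻¹ M)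
    preimage-of M-min = preimage-minimal ih embedded small M-min (minimal⊆image M-min)
    τ₂⊆gτ₁′ : ∀ {z} → τF T₂ (suc k₂) B₂ z → ∃[ z₁ ] g z₁ ≡ z × τF T₁ (suc k₁) B₁ z₁
    τ₂⊆gτ₁′ (M , M-min , z∈M) with y , y∈B₁ , refl ← ∈image⁻ (minimal⊆image M-min z∈M) =
      y , refl , B₁ ∩ g⁻¹ M , preimage-of M-min , x∈p∩q⁺ (y∈B₁ , ∈g⁻¹⁺ z∈M)
    gτ₁⊆τ₂′ : ∀ {z₁} → τF T₁ (suc k₁) B₁ z₁ → ¬ ¬ τF T₂ (suc k₂) B₂ (g z₁)
    gτ₁⊆τ₂′ {z₁} (M₁ , M₁-min@((M₁⊆B₁ , _) , _) , z₁∈M₁) = do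
      (M , M-min , _) ←
        ∃-minimal-retentive-⊆ T₂ (retentive-whole T₂ (g z₁ , maps-into (M₁⊆B₁ z₁∈M₁)))
      let z₁∈preimage = minimal-retentive-unique T₁ small fuel₁ M₁-min (preimage-of M-min) z₁∈M₁
      pure (M , M-min , ∈g⁻¹⁻ (proj₂ (x∈p∩q⁻ B₁ (g⁻¹ M) z₁∈preimage)))

  transfer : ∀ k₁ k₂ → Transfer k₁ k₂
  transfer zero k₂ aligned = record
    { τ₂⊆gτ₁ = λ z∈τ → let (y , y∈B₁ , _) = ∈image⁻ (τ⊆image z∈τ) in
                         contradiction y∈B₁ (∣p∣≤0⇒x∉p fuel₁)
    ; gτ₁⊆τ₂ = λ ()
    }
    where open Aligned aligned
  transfer (suc k₁) zero aligned = record
    { τ₂⊆gτ₁ = λ ()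
    ; gτ₁⊆τ₂ = λ z₁∈τ → contradiction (maps-into (τF⊆ T₁ (suc k₁) _ z₁∈τ)) (∣p∣≤0⇒x∉p fuel₂)
    }
    where open Aligned aligned
  transfer (suc k₁) (suc k₂) = transfer-step (transfer k₁ k₂)

lemma11 : ∀ {h} (H : Tournament h) (R : Subset h) →
    LocallyBounded 3 H R →
    Nonempty (∁ R) →
    (∀ v → v ∈ R → ∣ N⁻ H ⊤ v ∣ ≤ 5) →
    ¬ IsTauRetentiveTournament H
lemma11 {h} H R (R-retentive , _) (u , u∈∁R) in-degree≤5
        (m , T , S , (S-retentive , S-minimal) , f , f-injective , f-onto-S , f∈S , f-beats) =
  S-minimal (image R)
    (image-retentive (transfer h m) embedded S-retentive S⊆image R-retentive image⊆S
       (in-degree≤5 _))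
    (image⊆S , f u , f∈S u , fu∉image)
  where
  open Embedding H T f f-injective f-beats
  embedded : Embedded (suc h) (suc m) ⊤ ⊤
  embedded = record
    { fuel₁ = m≤n⇒m≤1+n (∣p∣≤n ⊤) ; fuel₂ = m≤n⇒m≤1+n (∣p∣≤n ⊤) ; maps-into = λ _ → ∈⊤ }
  S⊆image : S ⊆ image ⊤
  S⊆image x∈S with i , refl ← f-onto-S _ x∈S = ∈image⁺ ∈⊤ refl
  image⊆S : image R ⊆ S
  image⊆S x∈ with i , _ , refl ← ∈image⁻ x∈ = f∈S i
  fu∉image : f u ∉ image R
  fu∉image fu∈ with v , v∈R , fv≡fu ← ∈image⁻ fu∈ =
    x∈∁p⇒x∉p u∈∁R (subst (_∈ R) (f-injective v u fv≡fu) v∈R)
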